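{- In the setting below, for every realization of the $D^\alpha$ seeding procedure and every $i\ge 0$, we have $w_i(k)\ge |U_k^{(i)}|$.
   Context: Let $\mathcal{X}\subset\mathbb{R}^d$ be finite, $k\ge1$, $\alpha>2$, and let $(C_1,\dots,C_k)$ be a partition of $\mathcal{X}$ into nonempty clusters. $D^\alpha$ seeding chooses $z_1$ uniformly in $\mathcal{X}$ and, for $2\le t\le k$, chooses $z_t\in\mathcal{X}$ with probability proportional to $\min_{c\in Z_{t-1}}\lVert z-c\rVert^\alpha$, where $Z_t=\{z_1,\dots,z_t\}$. Let $H_t$ be the set of clusters meeting $Z_t$ ($H_0=\emptyset$) and $U_t$ the remaining clusters. For $i\ge0$ let $S_i$ be the set of clusters $C$ with $|C|\in[2^i,2^{i+1})$, $k_i=|S_i|$, and $U_t^{(i)}=U_t\cap S_i$. Counters: $\tau_j(0)=w_j(0)=0$ for all $j\ge 0$. For $t=1,\dots,k$, let $C$ be the cluster containing $z_t$, with $C\in S_i$. If $C\in U_{t-1}$: $\tau_i(t)=\tau_i(t-1)+1$ if $\tau_i(t-1)<k_i$ and $\tau_i(t)=\tau_i(t-1)$ otherwise; $\tau_j(t)=\tau_j(t-1)$ for $j\ne i$; $w_j(t)=w_j(t-1)$ for all $j$. If $C\in H_{t-1}$: for every $j$ with $\tau_j(t-1)<k_j$, $\tau_j(t)=\tau_j(t-1)+1$ and $w_j(t)=w_j(t-1)+1$; for every $j$ with $\tau_j(t-1)\ge k_j$, $\tau_j(t)=\tau_j(t-1)$ and $w_j(t)=w_j(t-1)$. -}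

module Defs where

open import Data.Nat using (ℕ; zero; suc; _+_; _^_; _≤_; _<_; _≤?_; _<?_)
open import Data.Bool using (Bool; true; false; if_then_else_; _∧_; not)
open import Data.Fin using (Fin; zero; suc)
open import Data.Fin.Properties using (_≟_)
open import Data.List using (List; []; _∷_; _++_)
open import Data.Bool.ListAction using (any)
open import Data.Product using (_×_; _,_; proj₁; proj₂)
open import Relation.Nullary.Decidable using (does; _×-dec_)

-- Points of X are labelled by Fin n; the partition into clusters C_1..C_k
-- is given by the cluster-assignment map  cl : Fin n → Fin k.

countF : (m : ℕ) → (Fin m → Bool) → ℕ
countF zero    p = 0
countF (suc m) p = (if p zero then 1 else 0) + countF m (λ x → p (suc x))

module Clustering {n k : ℕ} (cl : Fin n → Fin k) where

  size : Fin k → ℕ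
  size c = countF n (λ x → does (cl x ≟ c))

  inS : ℕ → Fin k → Bool
  inS i c = does ((2 ^ i ≤? size c) ×-dec (size c <? 2 ^ suc i))

  kk : ℕ → ℕ
  kk i = countF k (inS i)

  hit : List (Fin n) → Fin k → Bool
  hit zs c = any (λ z → does (cl z ≟ c)) zs

  numU : List (Fin n) → ℕ → ℕ
  numU zs i = countF k (λ c → inS i c ∧ not (hit zs c))

  Counters : Set
  Counters = (ℕ → ℕ) × (ℕ → ℕ)

  initial : Counters
  initial = (λ _ → 0) , (λ _ → 0)

  step : List (Fin n) → Fin n → Counters → Counters
  step past z (τ , w) with hit past (cl z)
  ... | false = (λ j → if inS j (cl z) ∧ does (τ j <? kk j) then suc (τ j) else τ j) , w
  ... | true  = (λ j → if does (τ j <? kk j) then suc (τ j) else τ j)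
              , (λ j → if does (τ j <? kk j) then suc (w j) else w j)

  go : List (Fin n) → List (Fin n) → Counters → Counters
  go past []       s = s
  go past (z ∷ zs) s = go (past ++ (z ∷ [])) zs (step past z s)

  run : List (Fin n) → Counters
  run zs = go [] zs initial

  w-final : List (Fin n) → ℕ → ℕ
  w-final zs = proj₂ (run zs)

{-# OPTIONS --safe #-}
-- Fix i and write K = k_i.  Along the run, τ_i ≤ w_i + a, where a is the number of hit
-- clusters in S_i, since τ_i only grows without w_i when a fresh S_i-cluster is hit.
-- Moreover, until τ_i saturates at K every chosen point raises τ_i or hits a fresh
-- cluster outside S_i, so t ≤ τ_i + o with o the number of hit clusters outside S_i.
-- After k steps o + K ≤ k forces τ_i ≥ K, hence a + |U^{(i)}| = K ≤ τ_i ≤ w_i + a.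
module Submission where

open import Defs
open import Data.Nat using (ℕ; _≤_; _≥_)
open import Data.Fin using (Fin)
open import Data.List using (List; length)
open import Data.List.Relation.Unary.Unique.Propositional using (Unique)
open import Data.Product using (∃)
open import Relation.Binary.PropositionalEquality using (_≡_)

open import Data.Nat using (zero; suc; _+_; _<ᵇ_; z≤n; s≤s)
open import Data.Nat.Properties
  using (≤-reflexive; ≤-trans; n≤1+n; +-suc; +-comm; +-assoc; +-monoˡ-≤; +-monoʳ-≤;
         +-cancelˡ-≤; ≮⇒≥; <⇒<ᵇ; module ≤-Reasoning)
open import Data.Fin using (zero; suc)
open import Data.Fin.Properties using (_≟_; suc-injective)
open import Data.Bool using (Bool; T; true; false; if_then_else_; _∧_; _∨_; not)
open import Data.Bool.Properties using (∨-identityʳ; ∨-zeroʳ; ∨-assoc; ∧-identityʳ; ∧-zeroʳ)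
open import Data.List using ([]; _∷_; _++_)
open import Data.List.Properties using (length-++; ++-assoc; ++-identityʳ)
open import Data.Product using (_,_)
open import Data.Sum using (_⊎_; inj₁; inj₂; [_,_]′)
import Data.Sum as Sum
open import Function using (id)
open import Relation.Binary.PropositionalEquality using (refl; sym; trans; cong; subst; _≢_)
open import Relation.Nullary using (yes; no; does)

indicator : Bool → ℕ
indicator b = if b then 1 else 0

countF-cong : ∀ m {p q : Fin m → Bool} → (∀ x → p x ≡ q x) → countF m p ≡ countF m q
countF-cong zero    e = refl
countF-cong (suc m) e rewrite e zero = cong (_ +_) (countF-cong m (λ x → e (suc x)))

countF-const-true : ∀ m → countF m (λ _ → true) ≡ m
countF-const-true zero    = refl
countF-const-true (suc m) = cong suc (countF-const-true m)

countF-∧-not : ∀ m (p q : Fin m → Bool) →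
  countF m p ≡ countF m (λ x → p x ∧ q x) + countF m (λ x → p x ∧ not (q x))
countF-∧-not zero    p q = refl
countF-∧-not (suc m) p q with p zero | q zero
... | false | _     = countF-∧-not m _ _
... | true  | true  = cong suc (countF-∧-not m _ _)
... | true  | false = trans (cong suc (countF-∧-not m _ _)) (sym (+-suc _ _))

countF-mono : ∀ m {p q : Fin m → Bool} → (∀ x → p x ≡ true → q x ≡ true) →
  countF m p ≤ countF m q
countF-mono zero    h = z≤n
countF-mono (suc m) {p} {q} h with p zero in ep | q zero in eq
... | false | false = countF-mono m (λ x → h (suc x))
... | false | true  = ≤-trans (countF-mono m (λ x → h (suc x))) (n≤1+n _)
... | true  | true  = s≤s (countF-mono m (λ x → h (suc x)))
... | true  | false with () ← trans (sym (h zero ep)) eq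

countF-insert : ∀ m {p p' : Fin m → Bool} (c : Fin m) → p c ≡ false →
  (∀ x → x ≢ c → p x ≡ p' x) → countF m p' ≡ indicator (p' c) + countF m p
countF-insert (suc m) zero e agree rewrite e =
  cong (_ +_) (sym (countF-cong m (λ x → agree (suc x) (λ ()))))
countF-insert (suc m) {p} {p'} (suc c) e agree rewrite sym (agree zero (λ ())) =
  trans (cong (indicator (p zero) +_) rest) (swap (indicator (p zero)) (indicator (p' (suc c))) _)
  where
  rest : countF m (λ x → p' (suc x)) ≡ indicator (p' (suc c)) + countF m (λ x → p (suc x))
  rest = countF-insert m c e (λ x x≢c → agree (suc x) (λ eq → x≢c (suc-injective eq)))
  swap : ∀ x y z → x + (y + z) ≡ y + (x + z)
  swap x y z = trans (sym (+-assoc x y z)) (trans (cong (_+ z) (+-comm x y)) (+-assoc y x z))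

module SaturatingCounter (K : ℕ) where

  -- does (τ <? K) in step computes to τ <ᵇ K.
  bump : ℕ → ℕ → ℕ
  bump τ x = if τ <ᵇ K then suc x else x

  <ᵇ-false⇒≥ : ∀ {τ} → (τ <ᵇ K) ≡ false → K ≤ τ
  <ᵇ-false⇒≥ τ≮K = ≮⇒≥ (λ τ<K → subst T τ≮K (<⇒<ᵇ τ<K))

  -- a counts the hit clusters of the tracked size class, o those of the other classes.
  record Invariant (τ w a o t : ℕ) : Set where
    constructor _,_
    field
      τ≤w+a              : τ ≤ w + a
      saturated⊎tracking : K ≤ τ ⊎ t ≤ τ + o

  invariant-fresh-inside : ∀ {τ w a o t} → Invariant τ w a o t →
    Invariant (bump τ τ) w (suc a) o (suc t)
  invariant-fresh-inside {τ} {w} {a} (τ≤w+a , sat) with τ <ᵇ K in τ<ᵇK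
  ... | true  = ≤-trans (s≤s τ≤w+a) (≤-reflexive (sym (+-suc w a)))
              , Sum.map (λ K≤τ → ≤-trans K≤τ (n≤1+n _)) s≤s sat
  ... | false = ≤-trans τ≤w+a (+-monoʳ-≤ w (n≤1+n a)) , inj₁ (<ᵇ-false⇒≥ τ<ᵇK)

  invariant-fresh-outside : ∀ {τ w a o t} → Invariant τ w a o t →
    Invariant τ w a (suc o) (suc t)
  invariant-fresh-outside {τ} {o = o} (τ≤w+a , sat) =
    τ≤w+a , Sum.map id (λ t≤τ+o → ≤-trans (s≤s t≤τ+o) (≤-reflexive (sym (+-suc τ o)))) sat

  invariant-repeat : ∀ {τ w a o t} → Invariant τ w a o t →
    Invariant (bump τ τ) (bump τ w) a o (suc t)
  invariant-repeat {τ} (τ≤w+a , sat) with τ <ᵇ K in τ<ᵇK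
  ... | true  = s≤s τ≤w+a , Sum.map (λ K≤τ → ≤-trans K≤τ (n≤1+n _)) s≤s sat
  ... | false = τ≤w+a , inj₁ (<ᵇ-false⇒≥ τ<ᵇK)

  invariant-final : ∀ {τ w a o t u} → Invariant τ w a o t →
    o + K ≤ t → K ≡ a + u → u ≤ w
  invariant-final {τ} {w} {a} {o} {t} {u} (τ≤w+a , sat) o+K≤t K≡a+u =
    +-cancelˡ-≤ a u w (begin
      a + u ≡⟨ sym K≡a+u ⟩
      K     ≤⟨ [ id , K≤τ ]′ sat ⟩
      τ     ≤⟨ τ≤w+a ⟩
      w + a ≡⟨ +-comm w a ⟩
      a + w ∎)
    where
    open ≤-Reasoning
    K≤τ : t ≤ τ + o → K ≤ τ
    K≤τ t≤τ+o = +-cancelˡ-≤ o K τ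
      (≤-trans o+K≤t (≤-trans t≤τ+o (≤-reflexive (+-comm τ o))))

module Run {n k : ℕ} (cl : Fin n → Fin k) (i : ℕ) where
  open Clustering cl
  open SaturatingCounter (kk i)

  hit-snoc : ∀ P z c → hit (P ++ z ∷ []) c ≡ hit P c ∨ does (cl z ≟ c)
  hit-snoc []      z c = ∨-identityʳ _
  hit-snoc (x ∷ P) z c rewrite hit-snoc P z c = sym (∨-assoc (does (cl x ≟ c)) (hit P c) _)

  hitCount : (Fin k → Bool) → List (Fin n) → ℕ
  hitCount q P = countF k (λ c → q c ∧ hit P c)

  hitCount-snoc-repeat : ∀ q P z → hit P (cl z) ≡ true → hitCount q (P ++ z ∷ []) ≡ hitCount q P
  hitCount-snoc-repeat q P z hz = countF-cong k (λ c → cong (q c ∧_) (hit-unchanged c))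
    where
    hit-unchanged : ∀ c → hit (P ++ z ∷ []) c ≡ hit P c
    hit-unchanged c rewrite hit-snoc P z c with cl z ≟ c
    ... | yes refl rewrite hz = refl
    ... | no _ = ∨-identityʳ _

  hitCount-snoc-fresh : ∀ q P z → hit P (cl z) ≡ false →
    hitCount q (P ++ z ∷ []) ≡ indicator (q (cl z)) + hitCount q P
  hitCount-snoc-fresh q P z hz =
    trans (countF-insert k (cl z) (trans (cong (q (cl z) ∧_) hz) (∧-zeroʳ _)) agree)
          (cong (λ b → indicator b + hitCount q P) now-hit)
    where
    now-hit : q (cl z) ∧ hit (P ++ z ∷ []) (cl z) ≡ q (cl z)
    now-hit rewrite hit-snoc P z (cl z) with cl z ≟ cl z
    ... | yes _ rewrite ∨-zeroʳ (hit P (cl z)) = ∧-identityʳ _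
    ... | no ¬refl with () ← ¬refl refl
    agree : ∀ c → c ≢ cl z → q c ∧ hit P c ≡ q c ∧ hit (P ++ z ∷ []) c
    agree c c≢ rewrite hit-snoc P z c with cl z ≟ c
    ... | yes eq with () ← c≢ (sym eq)
    ... | no _ = cong (q c ∧_) (sym (∨-identityʳ _))

  inside outside : List (Fin n) → ℕ
  inside  = hitCount (inS i)
  outside = hitCount (λ c → not (inS i c))

  Inv : List (Fin n) → Counters → Set
  Inv P (τ , w) = Invariant (τ i) (w i) (inside P) (outside P) (length P)

  length-snoc : ∀ (P : List (Fin n)) z → length (P ++ z ∷ []) ≡ suc (length P)
  length-snoc P z = trans (length-++ P) (+-comm (length P) 1)

  step-preserves : ∀ P z s → Inv P s → Inv (P ++ z ∷ []) (step P z s)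
  step-preserves P z (τ , w) inv with hit P (cl z) in hz
  ... | true
    rewrite hitCount-snoc-repeat (inS i) P z hz
          | hitCount-snoc-repeat (λ c → not (inS i c)) P z hz
          | length-snoc P z
    = invariant-repeat inv
  ... | false
    rewrite hitCount-snoc-fresh (inS i) P z hz
          | hitCount-snoc-fresh (λ c → not (inS i c)) P z hz
          | length-snoc P z
    with inS i (cl z)
  ...   | true  = invariant-fresh-inside inv
  ...   | false = invariant-fresh-outside inv

  go-preserves : ∀ zs P s → Inv P s → Inv (P ++ zs) (go P zs s)
  go-preserves []       P s inv = subst (λ Q → Inv Q s) (sym (++-identityʳ P)) inv
  go-preserves (z ∷ zs) P s inv =
    subst (λ Q → Inv Q (go (P ++ z ∷ []) zs (step P z s))) (++-assoc P (z ∷ []) zs)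
      (go-preserves zs (P ++ z ∷ []) (step P z s) (step-preserves P z s inv))

  run-invariant : ∀ zs → Inv zs (run zs)
  run-invariant zs = go-preserves zs [] initial (z≤n , inj₂ z≤n)

  kk≡inside+numU : ∀ zs → kk i ≡ inside zs + numU zs i
  kk≡inside+numU zs = countF-∧-not k (inS i) (hit zs)

  outside+kk≤k : ∀ zs → outside zs + kk i ≤ k
  outside+kk≤k zs = begin
    outside zs + kk i                              ≤⟨ +-monoˡ-≤ (kk i) (countF-mono k outside⊆) ⟩
    countF k (λ c → not (inS i c)) + kk i          ≡⟨ +-comm _ (kk i) ⟩
    kk i + countF k (λ c → not (inS i c))          ≡⟨ sym (countF-∧-not k (λ _ → true) (inS i)) ⟩
    countF k (λ _ → true)                          ≡⟨ countF-const-true k ⟩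
    k                                              ∎
    where
    open ≤-Reasoning
    outside⊆ : ∀ c → (not (inS i c) ∧ hit zs c) ≡ true → not (inS i c) ≡ true
    outside⊆ c e with inS i c
    ... | false = refl

lemma1 : (n k : ℕ) → 1 ≤ k → (cl : Fin n → Fin k) → (∀ c → ∃ λ x → cl x ≡ c)
    → (zs : List (Fin n)) → length zs ≡ k → Unique zs
    → ∀ (i : ℕ) → Clustering.w-final cl zs i ≥ Clustering.numU cl zs i
lemma1 n k _ cl _ zs length≡k _ i =
  invariant-final (run-invariant zs)
    (≤-trans (outside+kk≤k zs) (≤-reflexive (sym length≡k)))
    (kk≡inside+numU zs)
  where
  open Run cl i
  open SaturatingCounter (Clustering.kk cl i)
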